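{- A matroid $M$ is claw-free and anticlaw-free if and only if $M$ is a target.
   Context: A matroid is a pair $M=(E,G)$ where $G$ is the set of nonzero vectors of a finite-dimensional $\mathbb F_2$-vector space $V(G)=G\cup\{0\}$ and $E\subseteq G$. Isomorphism: a linear isomorphism of ambient spaces mapping ground sets onto each other. A flat of $G$ is a set $F\subseteq G$ with $F\cup\{0\}$ a subspace (the empty set is a flat). $M|F=(E\cap F,F)$; $M$ is $N$-free if no induced restriction $M|F$ is isomorphic to $N$. A claw is $(B,G)$ with $\dim G=3$ and $B$ a basis of $V(G)$; an anticlaw is the complement $(G\setminus B,G)$ of a claw. $M$ is a target if there exist flats $F_0\subseteq F_1\subseteq\cdots\subseteq F_k\subseteq G$ (possibly empty) such that $E$ is the union of the sets $F_{i+1}\setminus F_i$ over all even $i<k$. -}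

module Defs where

open import Data.Bool using (Bool; true; false; _xor_; if_then_else_)
open import Data.Nat using (ℕ; zero; suc)
open import Data.Nat.Divisibility using (_∣_)
open import Data.Fin using (Fin; toℕ; inject₁) renaming (suc to fsuc)
open import Data.Vec using (Vec; replicate; zipWith)
open import Data.Product using (Σ; ∃; ∃-syntax; _×_; _,_)
open import Data.Sum using (_⊎_)
open import Relation.Binary.PropositionalEquality using (_≡_; _≢_)
open import Relation.Nullary using (¬_)
open import Function.Bundles using (_⇔_)
open import Function.Definitions using (Injective)

-- The F₂-vector space F₂ⁿ, with F₂ = Bool (xor = addition, and = multiplication).
V : ℕ → Set
V n = Vec Bool n

0v : {n : ℕ} → V n
0v {n} = replicate n false

infixl 6 _⊕_
_⊕_ : {n : ℕ} → V n → V n → V n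
_⊕_ = zipWith _xor_

infixl 7 _·_
_·_ : {n : ℕ} → Bool → V n → V n
c · v = if c then v else 0v

-- A (binary) matroid with ambient space V(G) = F₂ⁿ, G = F₂ⁿ ∖ {0},
-- ground set E ⊆ G given by its (decidable) indicator function.
record Matroid (n : ℕ) : Set where
  field
    E     : V n → Bool
    E-0   : E 0v ≡ false
open Matroid public

-- S is (the indicator of) a linear subspace of F₂ⁿ.
-- A flat F of G is encoded by the subspace S = F ∪ {0}; F = {v ≠ 0 | S v}.
IsSubspace : {n : ℕ} → (V n → Bool) → Set
IsSubspace S = (S 0v ≡ true) × (∀ x y → S x ≡ true → S y ≡ true → S (x ⊕ y) ≡ true)

-- Linear maps over F₂ (additivity suffices over F₂).
IsLinear : {k n : ℕ} → (V k → V n) → Set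
IsLinear φ = ∀ x y → φ (x ⊕ y) ≡ φ x ⊕ φ y

-- M has an induced restriction M|F isomorphic to N: an injective linear map
-- φ : V(N) → V(M) (whose image is F ∪ {0} for a flat F, so φ is a linear
-- isomorphism V(N) ≅ F ∪ {0}) mapping E(N) onto E(M) ∩ F.
HasRestrictionIso : {n k : ℕ} → Matroid n → Matroid k → Set
HasRestrictionIso {n} {k} M N =
  Σ (V k → V n) λ φ →
    IsLinear φ × Injective _≡_ _≡_ φ ×
    (∀ v → v ≢ 0v → ((E M (φ v) ≡ true) ⇔ (E N v ≡ true)))

Free : {n k : ℕ} → Matroid k → Matroid n → Set
Free N M = ¬ HasRestrictionIso M N

IsBasis3 : (V 3 → Bool) → Set
IsBasis3 B = ∃[ b₁ ] ∃[ b₂ ] ∃[ b₃ ]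
  ( (∀ v → (B v ≡ true) ⇔ (v ≡ b₁ ⊎ v ≡ b₂ ⊎ v ≡ b₃))
  × (∀ c₁ c₂ c₃ → c₁ · b₁ ⊕ c₂ · b₂ ⊕ c₃ · b₃ ≡ 0v →
        (c₁ ≡ false × c₂ ≡ false × c₃ ≡ false))
  × (∀ v → ∃[ c₁ ] ∃[ c₂ ] ∃[ c₃ ] (c₁ · b₁ ⊕ c₂ · b₂ ⊕ c₃ · b₃ ≡ v)) )

-- Claws and anticlaws (with ambient space F₂³; every 3-dimensional
-- ambient space is linearly isomorphic to F₂³).
IsClaw : Matroid 3 → Set
IsClaw N = Σ (V 3 → Bool) λ B → IsBasis3 B × (∀ v → (E N v ≡ true) ⇔ (B v ≡ true))

IsAnticlaw : Matroid 3 → Set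
IsAnticlaw N = Σ (V 3 → Bool) λ B → IsBasis3 B ×
  (∀ v → (E N v ≡ true) ⇔ ((v ≢ 0v) × (B v ≡ false)))

ClawFree : {n : ℕ} → Matroid n → Set
ClawFree M = ∀ (N : Matroid 3) → IsClaw N → Free N M

AnticlawFree : {n : ℕ} → Matroid n → Set
AnticlawFree M = ∀ (N : Matroid 3) → IsAnticlaw N → Free N M

-- Target: flats F₀ ⊆ F₁ ⊆ ⋯ ⊆ F_k (encoded by subspaces S i = F_i ∪ {0})
-- with E = ⋃_{i < k, i even} (F_{i+1} ∖ F_i).
IsTarget : {n : ℕ} → Matroid n → Set
IsTarget {n} M =
  ∃[ k ] Σ (Fin (suc k) → V n → Bool) λ S →
    (∀ i → IsSubspace (S i)) ×
    (∀ (i : Fin k) v → S (inject₁ i) v ≡ true → S (fsuc i) v ≡ true) ×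
    (∀ v → v ≢ 0v →
      ((E M v ≡ true) ⇔
       (∃[ i ] ((2 ∣ toℕ {k} i) × (S (fsuc i) v ≡ true) × (S (inject₁ i) v ≡ false)))))

-- Call the index of the first flat of a target containing v the level of v.  Levels
-- are ultrametric, ℓ(x + y) ≤ max(ℓ x, ℓ y), and membership in E depends only on the
-- level.  On F₂³ no ultrametric level function can single out a basis, or the
-- complement of a basis, so targets are claw- and anticlaw-free.
--
-- Conversely, let M be claw- and anticlaw-free.  If both E and its complement
-- spanned, they would still both span some 3-dimensional flat: in dimension ≥ 4 some
-- hyperplane keeps both spanning, since otherwise every hyperplane contains a
-- monochromatic strip {f = 0, g = 1}, and two strips of opposite colours can be made
-- to meet.  An exhaustive check shows that a 3-dimensional matroid in which both E
-- and its complement span is a claw or an anticlaw.  Hence some hyperplane complement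
-- is monochromatic; by induction the hyperplane carries levels with E the set of odd
-- levels, and putting the complement on top, at a level whose parity is its colour,
-- gives such levels for M.  Their sublevel sets are the flats of a target.

module Submission where

open import Defs
open import Algebra.Bundles using (CommutativeRing)
open import Data.Bool using (Bool; true; false; _xor_; _∧_; not; if_then_else_)
open import Data.Bool.Properties
  using (xor-assoc; xor-comm; xor-same; xor-identityˡ; xor-identityʳ; xor-∧-commutativeRing;
         ∧-comm; ∧-zeroʳ; ∧-distribˡ-xor; ∧-distribʳ-xor; ¬-not; not-¬; not-involutive)
  renaming (_≟_ to _≟ᵇ_)
open import Data.Empty using (⊥; ⊥-elim)
open import Data.Nat using (ℕ; zero; suc; _+_; _*_; _≤_; _<_; _⊔_; z≤n; s≤s; _≤?_; _<?_)
open import Data.Nat.Properties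
  using (≤-trans; ≤-refl; ≤-antisym; ≤-reflexive; <-irrefl; ≤-<-trans; <⇒≤; ≰⇒>; ≮⇒≥; ≤∧≢⇒<; <-cmp; n≤1+n; m≤n*m;
         m≤m⊔n; m≤n⊔m; ⊔-lub; ⊔-idem; ⊔-pres-<m; m≤n⇒m⊔n≡n; *-comm; even≢odd)
open import Data.Nat.Divisibility using (_∣_; divides)
open import Data.Fin using (Fin; toℕ; inject₁; fromℕ<) renaming (zero to fzero; suc to fsuc)
open import Data.Fin.Properties using (toℕ-inject₁; toℕ-fromℕ<)
open import Data.Product using (Σ; ∃-syntax; _×_; _,_; proj₁; proj₂)
open import Data.Sum using (_⊎_; inj₁; inj₂)
import Data.Sum as Sum
open import Data.Vec using ([]; _∷_)
open import Data.Vec.Properties using (zipWith-comm; zipWith-assoc; zipWith-identityˡ; zipWith-identityʳ; ≡-dec)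
open import Function using (_∘_)
open import Function.Definitions using (Injective)
open import Function.Bundles using (_⇔_; mk⇔; Equivalence)
open import Function.Properties.Equivalence using () renaming (trans to ⇔-trans; sym to ⇔-sym)
open import Relation.Binary.PropositionalEquality
  using (_≡_; _≢_; refl; sym; trans; cong; cong₂; subst; module ≡-Reasoning)
open import Relation.Binary.Definitions using (tri<; tri≈; tri>)
open import Relation.Nullary using (¬_; Dec; yes; no; does)
open import Relation.Nullary.Decidable using (map′; ¬?; _×-dec_; _⊎-dec_; _→-dec_; decidable-stable; from-yes; dec-true; dec-false)
open import Algebra.Properties.CommutativeSemigroup
  (CommutativeRing.+-commutativeSemigroup xor-∧-commutativeRing)
  using () renaming (interchange to xor-interchange)

⊕-comm : ∀ {n} (x y : V n) → x ⊕ y ≡ y ⊕ x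
⊕-comm = zipWith-comm xor-comm

⊕-assoc : ∀ {n} (x y z : V n) → (x ⊕ y) ⊕ z ≡ x ⊕ (y ⊕ z)
⊕-assoc = zipWith-assoc xor-assoc

⊕-identityˡ : ∀ {n} (x : V n) → 0v ⊕ x ≡ x
⊕-identityˡ = zipWith-identityˡ xor-identityˡ

⊕-identityʳ : ∀ {n} (x : V n) → x ⊕ 0v ≡ x
⊕-identityʳ = zipWith-identityʳ xor-identityʳ

⊕-self : ∀ {n} (x : V n) → x ⊕ x ≡ 0v
⊕-self []      = refl
⊕-self (a ∷ x) = cong₂ _∷_ (xor-same a) (⊕-self x)

⊕-cancelˡ : ∀ {n} (x y : V n) → x ⊕ (x ⊕ y) ≡ y
⊕-cancelˡ x y = begin
  x ⊕ (x ⊕ y)  ≡⟨ ⊕-assoc x x y ⟨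
  (x ⊕ x) ⊕ y  ≡⟨ cong (_⊕ y) (⊕-self x) ⟩
  0v ⊕ y       ≡⟨ ⊕-identityˡ y ⟩
  y            ∎
  where open ≡-Reasoning

⊕-cancelʳ : ∀ {n} (x y : V n) → (x ⊕ y) ⊕ y ≡ x
⊕-cancelʳ x y = trans (⊕-assoc x y y) (trans (cong (x ⊕_) (⊕-self y)) (⊕-identityʳ x))

⊕≡0v⇒≡ : ∀ {n} {x y : V n} → x ⊕ y ≡ 0v → x ≡ y
⊕≡0v⇒≡ {x = x} {y} eq = trans (sym (⊕-identityʳ x)) (trans (cong (x ⊕_) (sym eq)) (⊕-cancelˡ x y))

≡⇒⊕≡0v : ∀ {n} {x y : V n} → x ≡ y → x ⊕ y ≡ 0v
≡⇒⊕≡0v {x = x} refl = ⊕-self x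

⊕-interchange : ∀ {n} (a b c d : V n) → (a ⊕ b) ⊕ (c ⊕ d) ≡ (a ⊕ c) ⊕ (b ⊕ d)
⊕-interchange []      []      []      []      = refl
⊕-interchange (a ∷ w) (b ∷ x) (c ∷ y) (d ∷ z) =
  cong₂ _∷_ (xor-interchange a b c d) (⊕-interchange w x y z)

·-distribʳ-xor : ∀ {n} (a b : Bool) (x : V n) → (a xor b) · x ≡ a · x ⊕ b · x
·-distribʳ-xor true  true  x = sym (⊕-self x)
·-distribʳ-xor true  false x = sym (⊕-identityʳ x)
·-distribʳ-xor false b     x = sym (⊕-identityˡ (b · x))

xor≡false⇒≡ : ∀ {a b} → a xor b ≡ false → a ≡ b
xor≡false⇒≡ {true}  {true}  _ = refl
xor≡false⇒≡ {false} {false} _ = refl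

≡true⇔⇒≡ : ∀ {a b} → (a ≡ true) ⇔ (b ≡ true) → a ≡ b
≡true⇔⇒≡ {true}  {true}  _ = refl
≡true⇔⇒≡ {false} {false} _ = refl
≡true⇔⇒≡ {true}  {false} a⇔b = sym (Equivalence.to a⇔b refl)
≡true⇔⇒≡ {false} {true}  a⇔b = Equivalence.from a⇔b refl

infix 4 _≟V_
_≟V_ : ∀ {n} (x y : V n) → Dec (x ≡ y)
_≟V_ = ≡-dec _≟ᵇ_

IsEmbedding : ∀ {k n} → (V k → V n) → Set
IsEmbedding φ = IsLinear φ × Injective _≡_ _≡_ φ

∘-isEmbedding : ∀ {j k n} {φ : V k → V n} {ψ : V j → V k} → IsEmbedding φ → IsEmbedding ψ → IsEmbedding (φ ∘ ψ)
∘-isEmbedding {φ = φ} {ψ} (φ-lin , φ-inj) (ψ-lin , ψ-inj) =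
  (λ x y → trans (cong φ (ψ-lin x y)) (φ-lin (ψ x) (ψ y))) , ψ-inj ∘ φ-inj

linear-0v : ∀ {k n} {φ : V k → V n} → IsLinear φ → φ 0v ≡ 0v
linear-0v {φ = φ} φ-lin = begin
  φ 0v               ≡⟨ cong φ (⊕-self 0v) ⟨
  φ (0v ⊕ 0v)        ≡⟨ φ-lin 0v 0v ⟩
  φ 0v ⊕ φ 0v        ≡⟨ ⊕-self (φ 0v) ⟩
  0v                 ∎
  where open ≡-Reasoning

embedding-≢0v : ∀ {k n} {φ : V k → V n} → IsEmbedding φ → ∀ {v} → v ≢ 0v → φ v ≢ 0v
embedding-≢0v (φ-lin , φ-inj) v≢0 φv≡0 = v≢0 (φ-inj (trans φv≡0 (sym (linear-0v φ-lin))))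

trivialKernel⇒injective : ∀ {k n} {φ : V k → V n} → IsLinear φ → (∀ v → φ v ≡ 0v → v ≡ 0v) → Injective _≡_ _≡_ φ
trivialKernel⇒injective {φ = φ} φ-lin ker {x} {y} eq = ⊕≡0v⇒≡ (ker (x ⊕ y) (trans (φ-lin x y) (≡⇒⊕≡0v eq)))

-- Linear functionals, represented through the standard bilinear form

dot : ∀ {n} → V n → V n → Bool
dot []      []      = false
dot (a ∷ f) (x ∷ v) = (a ∧ x) xor dot f v

dot-⊕ʳ : ∀ {n} (f x y : V n) → dot f (x ⊕ y) ≡ dot f x xor dot f y
dot-⊕ʳ []      []      []      = refl
dot-⊕ʳ (a ∷ f) (b ∷ x) (c ∷ y) =
  trans (cong₂ _xor_ (∧-distribˡ-xor a b c) (dot-⊕ʳ f x y))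
        (xor-interchange (a ∧ b) (a ∧ c) (dot f x) (dot f y))

dot-⊕ˡ : ∀ {n} (f g x : V n) → dot (f ⊕ g) x ≡ dot f x xor dot g x
dot-⊕ˡ []      []      []      = refl
dot-⊕ˡ (a ∷ f) (b ∷ g) (c ∷ x) =
  trans (cong₂ _xor_ (∧-distribʳ-xor c a b) (dot-⊕ˡ f g x))
        (xor-interchange (a ∧ c) (b ∧ c) (dot f x) (dot g x))

dot-comm : ∀ {n} (f x : V n) → dot f x ≡ dot x f
dot-comm []      []      = refl
dot-comm (a ∷ f) (b ∷ x) = cong₂ _xor_ (∧-comm a b) (dot-comm f x)

dot-0vˡ : ∀ {n} (x : V n) → dot 0v x ≡ false
dot-0vˡ []      = refl
dot-0vˡ (_ ∷ x) = dot-0vˡ x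

dot-0vʳ : ∀ {n} (f : V n) → dot f 0v ≡ false
dot-0vʳ f = trans (dot-comm f 0v) (dot-0vˡ f)

dot-·ˡ : ∀ {n} (c : Bool) (f v : V n) → dot (c · f) v ≡ c ∧ dot f v
dot-·ˡ true  f v = refl
dot-·ˡ false f v = dot-0vˡ v

dot≡true⇒≢0vʳ : ∀ {n} f {v : V n} → dot f v ≡ true → v ≢ 0v
dot≡true⇒≢0vʳ f fv refl = not-¬ (dot-0vʳ f) fv

dot≡true⇒≢0vˡ : ∀ {n} {f : V n} v → dot f v ≡ true → f ≢ 0v
dot≡true⇒≢0vˡ v fv refl = not-¬ (dot-0vˡ v) fv

dot-≢ : ∀ {n} {f g : V n} v → dot f v ≡ true → dot g v ≡ false → f ≢ g
dot-≢ v fv gv refl = not-¬ gv fv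

witness : ∀ {n} (f : V n) → f ≢ 0v → ∃[ w ] dot f w ≡ true
witness []          f≢0 = ⊥-elim (f≢0 refl)
witness (true ∷ f)  _   = true ∷ 0v , cong (true xor_) (dot-0vʳ f)
witness (false ∷ f) f≢0 with witness f (f≢0 ∘ cong (false ∷_))
... | w , fw = false ∷ w , fw

-- For h ≢ 0v, solving h · v = 0 for the first
-- nonzero coordinate of h makes `embed h` an isomorphism of F₂ᵐ onto the
-- hyperplane h⊥; `project h` is its adjoint, i.e. restriction of functionals
-- to h⊥, equivalently the quotient map by ⟨h⟩.

embed : ∀ {m} → V (suc m) → V m → V (suc m)
embed (true ∷ h)            w       = dot h w ∷ w
embed {zero}  (false ∷ _)   _       = 0v
embed {suc m} (false ∷ h)   (x ∷ w) = x ∷ embed h w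

unembed : ∀ {m} → V (suc m) → V (suc m) → V m
unembed (true ∷ _)          (_ ∷ v) = v
unembed {zero}  (false ∷ _) _       = []
unembed {suc m} (false ∷ h) (x ∷ v) = x ∷ unembed h v

project : ∀ {m} → V (suc m) → V (suc m) → V m
project (true ∷ h)          (a ∷ k) = k ⊕ a · h
project {zero}  (false ∷ _) _       = []
project {suc m} (false ∷ h) (a ∷ k) = a ∷ project h k

lift : ∀ {m} → V (suc m) → V m → V (suc m)
lift (true ∷ _)          g       = false ∷ g
lift {zero}  (false ∷ _) _       = 0v
lift {suc m} (false ∷ h) (x ∷ g) = x ∷ lift h g

∷-injective : ∀ {m} {a b : Bool} {x y : V m} → a ∷ x ≡ b ∷ y → a ≡ b × x ≡ y
∷-injective refl = refl , refl

tail-≢0v : ∀ {m} {h : V m} → false ∷ h ≢ 0v → h ≢ 0v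
tail-≢0v h≢0 = h≢0 ∘ cong (false ∷_)

embed-linear : ∀ {m} (h : V (suc m)) → IsLinear (embed h)
embed-linear (true ∷ h)            x       y       = cong (_∷ x ⊕ y) (dot-⊕ʳ h x y)
embed-linear {zero}  (false ∷ [])  []      []      = refl
embed-linear {suc m} (false ∷ h)   (a ∷ x) (b ∷ y) = cong ((a xor b) ∷_) (embed-linear h x y)

embed-injective : ∀ {m} (h : V (suc m)) {x y : V m} → embed h x ≡ embed h y → x ≡ y
embed-injective (true ∷ h)          eq = proj₂ (∷-injective eq)
embed-injective {zero}  (false ∷ _) {[]} {[]} _ = refl
embed-injective {suc m} (false ∷ h) {_ ∷ _} {_ ∷ _} eq with ∷-injective eq
... | refl , eq′ = cong (_ ∷_) (embed-injective h eq′)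

embed-0v : ∀ {m} (h : V (suc m)) → embed h 0v ≡ 0v
embed-0v (true ∷ h)            = cong (_∷ 0v) (dot-0vʳ h)
embed-0v {zero}  (false ∷ _)   = refl
embed-0v {suc m} (false ∷ h)   = cong (false ∷_) (embed-0v h)

embed-≢0v : ∀ {m} (h : V (suc m)) {w : V m} → w ≢ 0v → embed h w ≢ 0v
embed-≢0v h w≢0 eq = w≢0 (embed-injective h (trans eq (sym (embed-0v h))))

dot-embed : ∀ {m} (h : V (suc m)) (w : V m) → dot h (embed h w) ≡ false
dot-embed (true ∷ h)          w       = xor-same (dot h w)
dot-embed {zero}  (false ∷ []) _      = refl
dot-embed {suc m} (false ∷ h) (_ ∷ w) = dot-embed h w

unembed-embed : ∀ {m} (h : V (suc m)) (w : V m) → unembed h (embed h w) ≡ w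
unembed-embed (true ∷ h)          w       = refl
unembed-embed {zero}  (false ∷ _) []      = refl
unembed-embed {suc m} (false ∷ h) (x ∷ w) = cong (x ∷_) (unembed-embed h w)

embed-unembed : ∀ {m} (h : V (suc m)) {v : V (suc m)} → h ≢ 0v → dot h v ≡ false →
                embed h (unembed h v) ≡ v
embed-unembed (true ∷ h)            {x ∷ v}  _   hv =
  cong (_∷ v) (sym (xor≡false⇒≡ hv))
embed-unembed {zero}  (false ∷ [])  h≢0 _  = ⊥-elim (h≢0 refl)
embed-unembed {suc m} (false ∷ h)   {x ∷ v}  h≢0 hv = cong (x ∷_) (embed-unembed h (tail-≢0v h≢0) hv)

unembed-linear : ∀ {m} (h : V (suc m)) {x y : V (suc m)} → h ≢ 0v →
                 dot h x ≡ false → dot h y ≡ false → unembed h (x ⊕ y) ≡ unembed h x ⊕ unembed h y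
unembed-linear h {x} {y} h≢0 hx hy = begin
  unembed h (x ⊕ y)                                       ≡⟨ cong (unembed h) (cong₂ _⊕_ (embed-unembed h h≢0 hx) (embed-unembed h h≢0 hy)) ⟨
  unembed h (embed h (unembed h x) ⊕ embed h (unembed h y)) ≡⟨ cong (unembed h) (embed-linear h _ _) ⟨
  unembed h (embed h (unembed h x ⊕ unembed h y))          ≡⟨ unembed-embed h _ ⟩
  unembed h x ⊕ unembed h y                                ∎
  where open ≡-Reasoning

dot-project : ∀ {m} (h k : V (suc m)) (w : V m) → dot k (embed h w) ≡ dot (project h k) w
dot-project (true ∷ h) (a ∷ k) w = begin
  (a ∧ dot h w) xor dot k w    ≡⟨ xor-comm (a ∧ dot h w) (dot k w) ⟩
  dot k w xor (a ∧ dot h w)    ≡⟨ cong (dot k w xor_) (dot-·ˡ a h w) ⟨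
  dot k w xor dot (a · h) w    ≡⟨ dot-⊕ˡ k (a · h) w ⟨
  dot (k ⊕ a · h) w            ∎
  where open ≡-Reasoning
dot-project {zero}  (false ∷ []) (a ∷ []) [] = trans (xor-identityʳ _) (∧-zeroʳ a)
dot-project {suc m} (false ∷ h) (a ∷ k)  (x ∷ w) = cong ((a ∧ x) xor_) (dot-project h k w)

dot-embedˡ : ∀ {m} (h : V (suc m)) (w : V m) (y : V (suc m)) → dot (embed h w) y ≡ dot w (project h y)
dot-embedˡ h w y = trans (dot-comm (embed h w) y) (trans (dot-project h y w) (dot-comm (project h y) w))

project-linear : ∀ {m} (h : V (suc m)) → IsLinear (project h)
project-linear (true ∷ h) (a ∷ x) (b ∷ y) =
  trans (cong (x ⊕ y ⊕_) (·-distribʳ-xor a b h)) (⊕-interchange x y (a · h) (b · h))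
project-linear {zero}  (false ∷ _) _       _       = refl
project-linear {suc m} (false ∷ h) (a ∷ x) (b ∷ y) = cong ((a xor b) ∷_) (project-linear h x y)

project-0v : ∀ {m} (h : V (suc m)) → project h 0v ≡ 0v
project-0v (true ∷ h)            = ⊕-identityʳ 0v
project-0v {zero}  (false ∷ _)   = refl
project-0v {suc m} (false ∷ h)   = cong (false ∷_) (project-0v h)

project-self : ∀ {m} (h : V (suc m)) → project h h ≡ 0v
project-self (true ∷ h)          = ⊕-self h
project-self {zero}  (false ∷ _) = refl
project-self {suc m} (false ∷ h) = cong (false ∷_) (project-self h)

project-lift : ∀ {m} (h : V (suc m)) (g : V m) → project h (lift h g) ≡ g
project-lift (true ∷ h)          g       = ⊕-identityʳ g
project-lift {zero}  (false ∷ []) []     = refl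
project-lift {suc m} (false ∷ h) (x ∷ g) = cong (x ∷_) (project-lift h g)

project≡0v : ∀ {m} (h : V (suc m)) {k : V (suc m)} → h ≢ 0v → project h k ≡ 0v → k ≡ 0v ⊎ k ≡ h
project≡0v (true ∷ h)          {true ∷ k}  _   eq = inj₂ (cong (true ∷_) (⊕≡0v⇒≡ eq))
project≡0v (true ∷ h)          {false ∷ k} _   eq = inj₁ (cong (false ∷_) (trans (sym (⊕-identityʳ k)) eq))
project≡0v {zero}  (false ∷ []) h≢0 _ = ⊥-elim (h≢0 refl)
project≡0v {suc m} (false ∷ h) {a ∷ k} h≢0 eq with ∷-injective eq
... | refl , eq′ with project≡0v h (tail-≢0v h≢0) eq′
...   | inj₁ refl = inj₁ refl
...   | inj₂ refl = inj₂ refl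

project-≢0v : ∀ {m} (h : V (suc m)) {k : V (suc m)} → h ≢ 0v → k ≢ 0v → k ≢ h → project h k ≢ 0v
project-≢0v h h≢0 k≢0 k≢h eq with project≡0v h h≢0 eq
... | inj₁ k≡0 = k≢0 k≡0
... | inj₂ k≡h = k≢h k≡h

project-≢ : ∀ {m} (h : V (suc m)) {k f : V (suc m)} → h ≢ 0v → k ≢ f → k ≢ h ⊕ f →
            project h k ≢ project h f
project-≢ h {k} {f} h≢0 k≢f k≢h⊕f eq with project≡0v h h≢0 (trans (project-linear h k f) (≡⇒⊕≡0v eq))
... | inj₁ k⊕f≡0 = k≢f (⊕≡0v⇒≡ k⊕f≡0)
... | inj₂ k⊕f≡h = k≢h⊕f (trans (sym (⊕-cancelʳ k f)) (cong (_⊕ f) k⊕f≡h))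

embed-isEmbedding : ∀ {m} (h : V (suc m)) → IsEmbedding (embed h)
embed-isEmbedding h = embed-linear h , embed-injective h

unembed-0v : ∀ {m} (f : V (suc m)) → unembed f 0v ≡ 0v
unembed-0v f = trans (cong (unembed f) (sym (embed-0v f))) (unembed-embed f 0v)

jointWitness : ∀ {n} (a b : V n) → a ≢ 0v → b ≢ 0v → ∃[ w ] dot a w ≡ true × dot b w ≡ true
jointWitness {zero}  [] _ a≢0 _ = ⊥-elim (a≢0 refl)
jointWitness {suc m} a b a≢0 b≢0 with a ≟V b
... | yes refl = let (w , aw) = witness a a≢0 in w , aw , aw
... | no a≢b =
  let (w , a′w) = witness (project (a ⊕ b) a) (project-≢0v (a ⊕ b) (a≢b ∘ ⊕≡0v⇒≡) a≢0 a≢a⊕b)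
      aw = trans (dot-project (a ⊕ b) a w) a′w
      -- a and b agree on (a ⊕ b)⊥
      a≡b = xor≡false⇒≡ (trans (sym (dot-⊕ˡ a b _)) (dot-embed (a ⊕ b) w))
  in embed (a ⊕ b) w , aw , trans (sym a≡b) aw
  where
  a≢a⊕b : a ≢ a ⊕ b
  a≢a⊕b eq = b≢0 (trans (sym (⊕-cancelˡ a b)) (trans (cong (a ⊕_) (sym eq)) (⊕-self a)))

OutsideSpan : ∀ {n} → V n → V n → V n → Set
OutsideSpan h f k = k ≢ 0v × k ≢ h × k ≢ f × k ≢ h ⊕ f

jointSolution : ∀ {m} (h f k g : V (suc (suc m))) → h ≢ 0v → f ≢ 0v → f ≢ h →
                OutsideSpan h f k → OutsideSpan h f g →
                ∃[ v ] dot h v ≡ false × dot f v ≡ false × dot k v ≡ true × dot g v ≡ true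
jointSolution h f k g h≢0 f≢0 f≢h k∉ g∉ =
  let (w , kw , gw) = jointWitness _ _ (reduce k∉) (reduce g∉)
  in embed h (embed f′ w) , dot-embed h _ , trans (dot-project h f _) (dot-embed f′ w) ,
     trans (through k w) kw , trans (through g w) gw
  where
  f′ = project h f
  reduce : ∀ {k} → OutsideSpan h f k → project f′ (project h k) ≢ 0v
  reduce (k≢0 , k≢h , k≢f , k≢h⊕f) =
    project-≢0v f′ (project-≢0v h h≢0 f≢0 f≢h) (project-≢0v h h≢0 k≢0 k≢h) (project-≢ h h≢0 k≢f k≢h⊕f)
  through : ∀ k w → dot k (embed h (embed f′ w)) ≡ dot (project f′ (project h k)) w
  through k w = trans (dot-project h k _) (dot-project f′ (project h k) w)

∀V? : ∀ n {P : V n → Set} → (∀ v → Dec (P v)) → Dec (∀ v → P v)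
∀V? zero    P? = map′ (λ p → λ { [] → p }) (λ ∀P → ∀P []) (P? [])
∀V? (suc n) P? = map′ (λ (p , q) → λ { (false ∷ v) → p v ; (true ∷ v) → q v })
                      (λ ∀P → ∀P ∘ (false ∷_) , ∀P ∘ (true ∷_))
                      (∀V? n (P? ∘ (false ∷_)) ×-dec ∀V? n (P? ∘ (true ∷_)))

∃V? : ∀ n {P : V n → Set} → (∀ v → Dec (P v)) → Dec (∃[ v ] P v)
∃V? zero    P? = map′ ([] ,_) (λ { ([] , p) → p }) (P? [])
∃V? (suc n) P? = map′ (λ { (inj₁ (v , p)) → false ∷ v , p ; (inj₂ (v , p)) → true ∷ v , p })
                      (λ { (false ∷ v , p) → inj₁ (v , p) ; (true ∷ v , p) → inj₂ (v , p) })
                      (∃V? n (P? ∘ (false ∷_)) ⊎-dec ∃V? n (P? ∘ (true ∷_)))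

¬∀V⇒∃¬ : ∀ n {P : V n → Set} → (∀ v → Dec (P v)) → ¬ (∀ v → P v) → ∃[ v ] ¬ P v
¬∀V⇒∃¬ n P? ¬∀ with ∃V? n (¬? ∘ P?)
... | yes ∃¬ = ∃¬
... | no ¬∃¬ = ⊥-elim (¬∀ λ v → decidable-stable (P? v) (λ ¬p → ¬∃¬ (v , ¬p)))

-- Spanning sets: P spans F₂ⁿ iff no nonzero functional vanishes on P

Spans : ∀ {n} → (V n → Set) → Set
Spans {n} P = ∀ f → f ≢ 0v → ∃[ v ] P v × dot f v ≡ true

Spans? : ∀ {n} {P : V n → Set} → (∀ v → Dec (P v)) → Dec (Spans P)
Spans? {n} P? = ∀V? n λ f → ¬? (f ≟V 0v) →-dec ∃V? n λ v → P? v ×-dec (dot f v ≟ᵇ true)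

¬Spans⇒annihilator : ∀ {n} {P : V n → Set} → (∀ v → Dec (P v)) → ¬ Spans P →
                      ∃[ g ] g ≢ 0v × (∀ v → P v → dot g v ≡ false)
¬Spans⇒annihilator {n} P? ¬span
  with ¬∀V⇒∃¬ n (λ f → ¬? (f ≟V 0v) →-dec ∃V? n λ v → P? v ×-dec (dot f v ≟ᵇ true)) ¬span
... | g , ¬g = g , (λ g≡0 → ¬g (λ g≢0 → ⊥-elim (g≢0 g≡0))) , λ v pv → ¬-not (λ gv → ¬g (λ _ → v , pv , gv))

BothSpan : ∀ {n} → (V n → Bool) → Set
BothSpan E = Spans (λ v → E v ≡ true) × Spans (λ v → E v ≡ false)

BothSpan? : ∀ {n} (E : V n → Bool) → Dec (BothSpan E)
BothSpan? E = Spans? (λ v → E v ≟ᵇ true) ×-dec Spans? (λ v → E v ≟ᵇ false)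

Spans-mono : ∀ {n} {P Q : V n → Set} → (∀ v → P v → Q v) → Spans P → Spans Q
Spans-mono P⇒Q span f f≢0 with span f f≢0
... | v , Pv , fv = v , P⇒Q v Pv , fv

BothSpan-cong : ∀ {n} {E E′ : V n → Bool} → (∀ v → E v ≡ E′ v) → BothSpan E → BothSpan E′
BothSpan-cong E≗E′ (spanT , spanF) =
  Spans-mono (λ v → trans (sym (E≗E′ v))) spanT , Spans-mono (λ v → trans (sym (E≗E′ v))) spanF

-- P spans f⊥; the functionals that are nonzero on f⊥ are those other than 0v and f
SpansKernel : ∀ {n} → (V n → Set) → V n → Set
SpansKernel P f = ∀ g → g ≢ 0v → g ≢ f → ∃[ v ] P v × dot f v ≡ false × dot g v ≡ true

spansSomeKernel : ∀ n {P : V (suc n) → Set} → Spans P → ∃[ f ] f ≢ 0v × SpansKernel P f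
spansSomeKernel zero    _ = true ∷ [] , (λ ()) , λ where
  (true ∷ [])  _   g≢f → ⊥-elim (g≢f refl)
  (false ∷ []) g≢0 _   → ⊥-elim (g≢0 refl)
spansSomeKernel (suc m) {P} span with span (true ∷ 0v) (λ ())
... | x , Px , x₀ with spansSomeKernel m {λ w → ∃[ y ] P y × project x y ≡ w} image-spans
  where
  image-spans : Spans (λ w → ∃[ y ] P y × project x y ≡ w)
  image-spans g g≢0 with span (embed x g) (embed-≢0v x g≢0)
  ... | y , Py , gy = project x y , (y , Py , refl) , trans (sym (dot-embedˡ x g y)) gy
... | f′ , f′≢0 , kernel′ = embed x f′ , embed-≢0v x f′≢0 , kernel
  where
  x≢0 : x ≢ 0v
  x≢0 = dot≡true⇒≢0vʳ (true ∷ 0v) x₀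
  kernel : SpansKernel P (embed x f′)
  kernel g g≢0 g≢f with dot g x ≟ᵇ true
  ... | yes gx = x , Px , trans (dot-comm _ x) (dot-embed x f′) , gx
  ... | no ¬gx with embed-unembed x x≢0 (trans (dot-comm x g) (¬-not ¬gx))
  ...   | g≡ with kernel′ (unembed x g) (λ eq → g≢0 (trans (sym g≡) (trans (cong (embed x) eq) (embed-0v x))))
                                      (λ eq → g≢f (trans (sym g≡) (cong (embed x) eq)))
  ...     | _ , (y , Py , refl) , f′y , g′y =
    y , Py , trans (dot-embedˡ x f′ y) f′y ,
    trans (cong (λ z → dot z y) (sym g≡)) (trans (dot-embedˡ x (unembed x g) y) g′y)

-- Strips: the sets {v | f · v = 0, g · v = 1}, half of the hyperplane f⊥

ConstantOn : ∀ {n} → (V n → Bool) → V n → V n → Bool → Set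
ConstantOn E f g b = ∀ v → dot f v ≡ false → dot g v ≡ true → E v ≡ b

HasConstantStrip : ∀ {n} → (V n → Bool) → V n → Set
HasConstantStrip E f = ∃[ g ] ∃[ b ] g ≢ 0v × g ≢ f × ConstantOn E f g b

¬Spans⇒constantStrip : ∀ {m} (E : V (suc m) → Bool) {f} b → f ≢ 0v →
                       ¬ Spans (λ w → E (embed f w) ≡ b) → HasConstantStrip E f
¬Spans⇒constantStrip E {f} b f≢0 ¬span with ¬Spans⇒annihilator (λ w → E (embed f w) ≟ᵇ b) ¬span
... | g′ , g′≢0 , g′⊥ = lift f g′ , not b , g≢0 , g≢f , constant
  where
  g≢0 : lift f g′ ≢ 0v
  g≢0 eq = g′≢0 (trans (sym (project-lift f g′)) (trans (cong (project f) eq) (project-0v f)))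
  g≢f : lift f g′ ≢ f
  g≢f eq = g′≢0 (trans (sym (project-lift f g′)) (trans (cong (project f) eq) (project-self f)))
  constant : ConstantOn E f (lift f g′) (not b)
  constant v fv gv = ¬-not λ Ev≡b → not-¬ (g′⊥ w (subst (λ u → E u ≡ b) (sym v≡) Ev≡b)) g′w
    where
    w = unembed f v
    v≡ : embed f w ≡ v
    v≡ = embed-unembed f f≢0 fv
    g′w : dot g′ w ≡ true
    g′w = begin
      dot g′ w                         ≡⟨ cong (λ z → dot z w) (project-lift f g′) ⟨
      dot (project f (lift f g′)) w    ≡⟨ dot-project f (lift f g′) w ⟨
      dot (lift f g′) (embed f w)      ≡⟨ cong (dot (lift f g′)) v≡ ⟩
      dot (lift f g′) v                ≡⟨ gv ⟩
      true                             ∎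
      where open ≡-Reasoning

constantStrip : ∀ {m} (E : V (suc m) → Bool) {f} → f ≢ 0v → ¬ BothSpan (E ∘ embed f) → HasConstantStrip E f
constantStrip E {f} f≢0 ¬both with Spans? (λ w → E (embed f w) ≟ᵇ true)
... | no ¬span = ¬Spans⇒constantStrip E true f≢0 ¬span
... | yes span = ¬Spans⇒constantStrip E false f≢0 (¬both ∘ (span ,_))

constantOn-colour : ∀ {n} {E : V n → Bool} {f g b c} → ConstantOn E f g b → g ≢ 0v → g ≢ f →
                    SpansKernel (λ v → E v ≡ c) f → b ≡ c
constantOn-colour constant g≢0 g≢f span with span _ g≢0 g≢f
... | v , Ev , fv , gv = trans (sym (constant v fv gv)) Ev

record AnchoredStrip {n} (E : V n → Bool) (b : Bool) : Set where
  field
    f g e    : V n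
    g≢0v     : g ≢ 0v
    g≢f      : g ≢ f
    constant : ConstantOn E f g b
    Ee       : E e ≡ b
    fe       : dot f e ≡ true

anchoredStrip : ∀ {m} (E : V (suc m) → Bool) b → Spans (λ v → E v ≡ b) →
                (∀ f → f ≢ 0v → HasConstantStrip E f) → AnchoredStrip E b
anchoredStrip E b span strips with spansSomeKernel _ span
... | f , f≢0 , kernel with strips f f≢0 | span f f≢0
... | g , b′ , g≢0 , g≢f , constant | e , Ee , fe =
  record { f = f ; g = g ; e = e ; g≢0v = g≢0 ; g≢f = g≢f
         ; constant = subst (ConstantOn E f g) (constantOn-colour constant g≢0 g≢f kernel) constant
         ; Ee = Ee ; fe = fe }

_∈_+⟨_⟩ : ∀ {n} → V n → V n → V n → Set
g ∈ h +⟨ f ⟩ = g ≡ h ⊎ g ≡ h ⊕ f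

_∈?_+⟨_⟩ : ∀ {n} (g h f : V n) → Dec (g ∈ h +⟨ f ⟩)
g ∈? h +⟨ f ⟩ = (g ≟V h) ⊎-dec (g ≟V h ⊕ f)

dot-⊕-odd : ∀ {n} (h f : V n) {e} → dot h e ≡ false → dot f e ≡ true → dot (h ⊕ f) e ≡ true
dot-⊕-odd h f {e} he fe = trans (dot-⊕ˡ h f e) (cong₂ _xor_ he fe)

∈+⟨⟩-unique : ∀ {n} {f g h h′ e : V n} → dot f e ≡ true → dot h e ≡ false → dot h′ e ≡ false →
               g ∈ h +⟨ f ⟩ → g ∈ h′ +⟨ f ⟩ → h ≡ h′
∈+⟨⟩-unique fe he h′e (inj₁ refl) (inj₁ refl) = refl
∈+⟨⟩-unique {h = h} {h′} fe he h′e (inj₂ g≡) (inj₂ g≡′) =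
  trans (sym (⊕-cancelʳ h _)) (trans (cong (_⊕ _) (trans (sym g≡) g≡′)) (⊕-cancelʳ h′ _))
∈+⟨⟩-unique {f = f} {h = h} {h′} {e} fe he h′e (inj₁ refl) (inj₂ g≡′) =
  ⊥-elim (not-¬ he (trans (cong (λ z → dot z e) g≡′) (dot-⊕-odd h′ f h′e fe)))
∈+⟨⟩-unique {f = f} {h = h} {h′} {e} fe he h′e (inj₂ g≡) (inj₁ refl) =
  ⊥-elim (not-¬ h′e (trans (cong (λ z → dot z e) g≡) (dot-⊕-odd h f he fe)))

-- The two strips meet, in a point whose colour would have to be both b and not b
strips-clash : ∀ {m} {E : V (suc (suc m)) → Bool} {b} (A : AnchoredStrip E b) {h k} →
               let open AnchoredStrip A in
               ConstantOn E h k (not b) → k ≢ 0v → k ≢ h → h ≢ 0v → dot h e ≡ false →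
               ¬ (g ∈ h +⟨ f ⟩) → ⊥
strips-clash {b = b} A {h} {k} constant′ k≢0 k≢h h≢0 he g∉ =
  let (v , hv , fv , kv , gv) = jointSolution h f k g h≢0 f≢0 f≢h
                                  (k≢0 , k≢h , k≢f , k≢h⊕f) (g≢0v , g≢h , g≢f , g≢h⊕f)
  in not-¬ (constant v fv gv) (constant′ v hv kv)
  where
  open AnchoredStrip A
  ke : dot k e ≡ false
  ke = ¬-not λ ke → not-¬ Ee (constant′ e he ke)
  f≢0 : f ≢ 0v
  f≢0 = dot≡true⇒≢0vˡ e fe
  f≢h : f ≢ h
  f≢h = dot-≢ e fe he
  k≢f : k ≢ f
  k≢f = dot-≢ e fe ke ∘ sym
  k≢h⊕f : k ≢ h ⊕ f
  k≢h⊕f = dot-≢ e (dot-⊕-odd h f he fe) ke ∘ sym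
  g≢h = g∉ ∘ inj₁
  g≢h⊕f = g∉ ∘ inj₂

outsideTwoSubsingletons : ∀ {X : Set} (C A B : X → Set) → (∀ x → Dec (A x)) → (∀ x → Dec (B x)) →
         (∀ {x y} → A x → A y → x ≡ y) → (∀ {x y} → B x → B y → x ≡ y) →
         (x₁ x₂ x₃ : X) → x₁ ≢ x₂ → x₁ ≢ x₃ → x₂ ≢ x₃ → C x₁ → C x₂ → C x₃ →
         ∃[ x ] C x × ¬ A x × ¬ B x
outsideTwoSubsingletons C A B A? B? A! B! x₁ x₂ x₃ x₁≢x₂ x₁≢x₃ x₂≢x₃ c₁ c₂ c₃ with A? x₁ | B? x₁
... | no ¬a₁ | no ¬b₁ = x₁ , c₁ , ¬a₁ , ¬b₁
... | yes a₁ | _ with B? x₂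
...   | no ¬b₂ = x₂ , c₂ , (λ a₂ → x₁≢x₂ (A! a₁ a₂)) , ¬b₂
...   | yes b₂ = x₃ , c₃ , (λ a₃ → x₁≢x₃ (A! a₁ a₃)) , (λ b₃ → x₂≢x₃ (B! b₂ b₃))
outsideTwoSubsingletons C A B A? B? A! B! x₁ x₂ x₃ x₁≢x₂ x₁≢x₃ x₂≢x₃ c₁ c₂ c₃ | no ¬a₁ | yes b₁ with A? x₂
...   | no ¬a₂ = x₂ , c₂ , ¬a₂ , (λ b₂ → x₁≢x₂ (B! b₁ b₂))
...   | yes a₂ = x₃ , c₃ , (λ a₃ → x₂≢x₃ (A! a₂ a₃)) , (λ b₃ → x₁≢x₃ (B! b₁ b₃))

annihilator₂ : ∀ {m} → V (2 + m) → V (2 + m) → V m → V (2 + m)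
annihilator₂ e e′ z = embed e (embed (project e e′) z)

annihilator₂-injective : ∀ {m} (e e′ : V (2 + m)) {z z′ : V m} →
                         annihilator₂ e e′ z ≡ annihilator₂ e e′ z′ → z ≡ z′
annihilator₂-injective e e′ = embed-injective (project e e′) ∘ embed-injective e

annihilator₂-vanishesˡ : ∀ {m} (e e′ : V (2 + m)) (z : V m) → dot (annihilator₂ e e′ z) e ≡ false
annihilator₂-vanishesˡ e e′ z = trans (dot-comm _ e) (dot-embed e _)

annihilator₂-vanishesʳ : ∀ {m} (e e′ : V (2 + m)) (z : V m) → dot (annihilator₂ e e′ z) e′ ≡ false
annihilator₂-vanishesʳ e e′ z =
  trans (dot-embedˡ e _ e′) (trans (dot-comm _ (project e e′)) (dot-embed (project e e′) z))

-- Among the three nonzero functionals of a plane of annihilators of e and e′,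
-- each coset h + ⟨f⟩ with f · e = 1 contains at most one.
commonAnnihilator : ∀ m {f g e f′ g′ e′ : V (4 + m)} → dot f e ≡ true → dot f′ e′ ≡ true →
                    ∃[ h ] h ≢ 0v × dot h e ≡ false × dot h e′ ≡ false ×
                           ¬ (g ∈ h +⟨ f ⟩) × ¬ (g′ ∈ h +⟨ f′ ⟩)
commonAnnihilator m {f} {g} {e} {f′} {g′} {e′} fe f′e′
  with outsideTwoSubsingletons (_≢ 0v) (λ z → g ∈ H z +⟨ f ⟩) (λ z → g′ ∈ H z +⟨ f′ ⟩)
              (λ z → g ∈? H z +⟨ f ⟩) (λ z → g′ ∈? H z +⟨ f′ ⟩)
              (λ p q → annihilator₂-injective e e′ (∈+⟨⟩-unique fe (He _) (He _) p q))
              (λ p q → annihilator₂-injective e e′ (∈+⟨⟩-unique f′e′ (He′ _) (He′ _) p q))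
              (true ∷ false ∷ 0v) (false ∷ true ∷ 0v) (true ∷ true ∷ 0v)
              (λ ()) (λ ()) (λ ()) (λ ()) (λ ()) (λ ())
  where
  H : V (2 + m) → V (4 + m)
  H = annihilator₂ e e′
  He : ∀ z → dot (H z) e ≡ false
  He = annihilator₂-vanishesˡ e e′
  He′ : ∀ z → dot (H z) e′ ≡ false
  He′ = annihilator₂-vanishesʳ e e′
... | z , z≢0 , ¬A , ¬B =
  annihilator₂ e e′ z , embed-≢0v e (embed-≢0v (project e e′) z≢0) ,
  annihilator₂-vanishesˡ e e′ z , annihilator₂-vanishesʳ e e′ z , ¬A , ¬B

¬allHyperplanesHaveConstantStrips : ∀ m (E : V (4 + m) → Bool) → BothSpan E →
                                    ¬ (∀ f → f ≢ 0v → HasConstantStrip E f)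
¬allHyperplanesHaveConstantStrips m E (spanT , spanF) strips =
  clash (anchoredStrip E true spanT strips) (anchoredStrip E false spanF strips)
  where
  clash : AnchoredStrip E true → AnchoredStrip E false → ⊥
  clash T F with commonAnnihilator m (AnchoredStrip.fe T) (AnchoredStrip.fe F)
  ... | h , h≢0 , he , he′ , ¬T , ¬F with strips h h≢0
  ...   | k , false , k≢0 , k≢h , constant = strips-clash T constant k≢0 k≢h h≢0 he ¬T
  ...   | k , true  , k≢0 , k≢h , constant = strips-clash F constant k≢0 k≢h h≢0 he′ ¬F

bothSpan⇒flat₃ : ∀ m (E : V (3 + m) → Bool) → BothSpan E →
                 Σ (V 3 → V (3 + m)) λ φ → IsEmbedding φ × BothSpan (E ∘ φ)
bothSpan⇒flat₃ zero    E both = (λ v → v) , ((λ _ _ → refl) , (λ eq → eq)) , both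
bothSpan⇒flat₃ (suc m) E both = descend (∃V? (4 + m) λ f → ¬? (f ≟V 0v) ×-dec BothSpan? (E ∘ embed f))
  where
  descend : Dec (∃[ f ] f ≢ 0v × BothSpan (E ∘ embed f)) →
            Σ (V 3 → V (4 + m)) λ φ → IsEmbedding φ × BothSpan (E ∘ φ)
  descend (yes (f , f≢0 , both′)) =
    let (φ , φ-emb , both″) = bothSpan⇒flat₃ m (E ∘ embed f) both′
    in embed f ∘ φ , ∘-isEmbedding (embed-isEmbedding f) φ-emb , both″
  descend (no ¬hyperplane) =
    ⊥-elim (¬allHyperplanesHaveConstantStrips m E both λ f f≢0 →
              constantStrip E f≢0 (λ both′ → ¬hyperplane (f , f≢0 , both′)))

-- Boolean functions on F₂ⁿ as finite tables, so that properties of all of them can be decided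

Table : ℕ → Set
Table zero    = Bool
Table (suc n) = Table n × Table n

⟦_⟧ : ∀ {n} → Table n → V n → Bool
⟦_⟧ {zero}  b         []          = b
⟦_⟧ {suc n} (t₀ , t₁) (false ∷ v) = ⟦ t₀ ⟧ v
⟦_⟧ {suc n} (t₀ , t₁) (true ∷ v)  = ⟦ t₁ ⟧ v

table : ∀ {n} → (V n → Bool) → Table n
table {zero}  E = E []
table {suc n} E = table (E ∘ (false ∷_)) , table (E ∘ (true ∷_))

⟦table⟧ : ∀ {n} (E : V n → Bool) v → ⟦ table E ⟧ v ≡ E v
⟦table⟧ E []          = refl
⟦table⟧ E (false ∷ v) = ⟦table⟧ (E ∘ (false ∷_)) v
⟦table⟧ E (true ∷ v)  = ⟦table⟧ (E ∘ (true ∷_)) v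

∀Table? : ∀ n {P : Table n → Set} → (∀ t → Dec (P t)) → Dec (∀ t → P t)
∀Table? zero    P? = map′ (λ (p , q) → λ { true → p ; false → q }) (λ ∀P → ∀P true , ∀P false)
                          (P? true ×-dec P? false)
∀Table? (suc n) P? = map′ (λ ∀∀ (t₀ , t₁) → ∀∀ t₀ t₁) (λ ∀P t₀ t₁ → ∀P (t₀ , t₁))
                          (∀Table? n λ t₀ → ∀Table? n λ t₁ → P? (t₀ , t₁))

¬bothSpan₁ : ∀ t → ¬ BothSpan (⟦_⟧ {1} t)
¬bothSpan₁ = from-yes (∀Table? 1 λ t → ¬? (BothSpan? ⟦ t ⟧))

¬bothSpan₂ : ∀ t → ¬ BothSpan (⟦_⟧ {2} t)
¬bothSpan₂ = from-yes (∀Table? 2 λ t → ¬? (BothSpan? ⟦ t ⟧))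

pattern e₁ = true  ∷ false ∷ false ∷ []
pattern e₂ = false ∷ true  ∷ false ∷ []
pattern e₃ = false ∷ false ∷ true  ∷ []

claw : V 3 → Bool
claw e₁ = true
claw e₂ = true
claw e₃ = true
claw _  = false

anticlaw : V 3 → Bool
anticlaw (false ∷ false ∷ false ∷ []) = false
anticlaw v                            = not (claw v)

anticlaw≡not-claw : ∀ {c} → c ≢ 0v → anticlaw c ≡ not (claw c)
anticlaw≡not-claw {false ∷ false ∷ false ∷ []} c≢0 = ⊥-elim (c≢0 refl)
anticlaw≡not-claw {e₁} _ = refl
anticlaw≡not-claw {e₂} _ = refl
anticlaw≡not-claw {e₃} _ = refl
anticlaw≡not-claw {true  ∷ true  ∷ false ∷ []} _ = refl
anticlaw≡not-claw {true  ∷ false ∷ true  ∷ []} _ = refl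
anticlaw≡not-claw {false ∷ true  ∷ true  ∷ []} _ = refl
anticlaw≡not-claw {true  ∷ true  ∷ true  ∷ []} _ = refl

anticlaw≡true⇒claw≡false : ∀ {c} → c ≢ 0v → anticlaw c ≡ true → claw c ≡ false
anticlaw≡true⇒claw≡false c≢0 ac = trans (sym (not-involutive _)) (cong not (trans (sym (anticlaw≡not-claw c≢0)) ac))

claw≡true⇒ : ∀ {c} → claw c ≡ true → c ≡ e₁ ⊎ c ≡ e₂ ⊎ c ≡ e₃
claw≡true⇒ {e₁} _ = inj₁ refl
claw≡true⇒ {e₂} _ = inj₂ (inj₁ refl)
claw≡true⇒ {e₃} _ = inj₂ (inj₂ refl)
claw≡true⇒ {false ∷ false ∷ false ∷ []} ()
claw≡true⇒ {true  ∷ true  ∷ false ∷ []} ()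
claw≡true⇒ {true  ∷ false ∷ true  ∷ []} ()
claw≡true⇒ {false ∷ true  ∷ true  ∷ []} ()
claw≡true⇒ {true  ∷ true  ∷ true  ∷ []} ()

linComb₃ : ∀ {n} → V n → V n → V n → V 3 → V n
linComb₃ b₁ b₂ b₃ (c₁ ∷ c₂ ∷ c₃ ∷ []) = c₁ · b₁ ⊕ c₂ · b₂ ⊕ c₃ · b₃

linComb₃-linear : ∀ {n} (b₁ b₂ b₃ : V n) → IsLinear (linComb₃ b₁ b₂ b₃)
linComb₃-linear b₁ b₂ b₃ (c₁ ∷ c₂ ∷ c₃ ∷ []) (d₁ ∷ d₂ ∷ d₃ ∷ []) = begin
  (c₁ xor d₁) · b₁ ⊕ (c₂ xor d₂) · b₂ ⊕ (c₃ xor d₃) · b₃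
    ≡⟨ cong₂ _⊕_ (cong₂ _⊕_ (·-distribʳ-xor c₁ d₁ b₁) (·-distribʳ-xor c₂ d₂ b₂)) (·-distribʳ-xor c₃ d₃ b₃) ⟩
  (c₁ · b₁ ⊕ d₁ · b₁) ⊕ (c₂ · b₂ ⊕ d₂ · b₂) ⊕ (c₃ · b₃ ⊕ d₃ · b₃)
    ≡⟨ cong (_⊕ (c₃ · b₃ ⊕ d₃ · b₃)) (⊕-interchange (c₁ · b₁) (d₁ · b₁) (c₂ · b₂) (d₂ · b₂)) ⟩
  (c₁ · b₁ ⊕ c₂ · b₂) ⊕ (d₁ · b₁ ⊕ d₂ · b₂) ⊕ (c₃ · b₃ ⊕ d₃ · b₃)
    ≡⟨ ⊕-interchange (c₁ · b₁ ⊕ c₂ · b₂) (d₁ · b₁ ⊕ d₂ · b₂) (c₃ · b₃) (d₃ · b₃) ⟩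
  (c₁ · b₁ ⊕ c₂ · b₂ ⊕ c₃ · b₃) ⊕ (d₁ · b₁ ⊕ d₂ · b₂ ⊕ d₃ · b₃)
    ∎
  where open ≡-Reasoning

linComb₃-basis : ∀ {n} (b₁ b₂ b₃ : V n) →
                 linComb₃ b₁ b₂ b₃ e₁ ≡ b₁ × linComb₃ b₁ b₂ b₃ e₂ ≡ b₂ × linComb₃ b₁ b₂ b₃ e₃ ≡ b₃
linComb₃-basis b₁ b₂ b₃ =
  trans (⊕-identityʳ _) (⊕-identityʳ b₁) ,
  trans (⊕-identityʳ _) (⊕-identityˡ b₂) ,
  trans (cong (_⊕ b₃) (⊕-identityˡ 0v)) (⊕-identityˡ b₃)

independent⇒trivialKernel : ∀ {n} {b₁ b₂ b₃ : V n} →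
  (∀ c₁ c₂ c₃ → c₁ · b₁ ⊕ c₂ · b₂ ⊕ c₃ · b₃ ≡ 0v → c₁ ≡ false × c₂ ≡ false × c₃ ≡ false) →
  ∀ c → linComb₃ b₁ b₂ b₃ c ≡ 0v → c ≡ 0v
independent⇒trivialKernel independent (c₁ ∷ c₂ ∷ c₃ ∷ []) eq with independent c₁ c₂ c₃ eq
... | refl , refl , refl = refl

basis-claw : ∀ {n} {B : V n → Bool} {b₁ b₂ b₃ : V n} → (∀ v → (B v ≡ true) ⇔ (v ≡ b₁ ⊎ v ≡ b₂ ⊎ v ≡ b₃)) →
             (∀ c → linComb₃ b₁ b₂ b₃ c ≡ 0v → c ≡ 0v) → ∀ c → B (linComb₃ b₁ b₂ b₃ c) ≡ claw c
basis-claw {B = B} {b₁} {b₂} {b₃} members kernel c = ≡true⇔⇒≡ (mk⇔ to from)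
  where
  α = linComb₃ b₁ b₂ b₃
  α-injective = trivialKernel⇒injective (linComb₃-linear b₁ b₂ b₃) kernel
  α₁ = proj₁ (linComb₃-basis b₁ b₂ b₃)
  α₂ = proj₁ (proj₂ (linComb₃-basis b₁ b₂ b₃))
  α₃ = proj₂ (proj₂ (linComb₃-basis b₁ b₂ b₃))
  to : B (α c) ≡ true → claw c ≡ true
  to Bαc with Equivalence.to (members (α c)) Bαc
  ... | inj₁ eq        = subst (λ x → claw x ≡ true) (sym (α-injective (trans eq (sym α₁)))) refl
  ... | inj₂ (inj₁ eq) = subst (λ x → claw x ≡ true) (sym (α-injective (trans eq (sym α₂)))) refl
  ... | inj₂ (inj₂ eq) = subst (λ x → claw x ≡ true) (sym (α-injective (trans eq (sym α₃)))) refl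
  from : claw c ≡ true → B (α c) ≡ true
  from clawc = Equivalence.from (members (α c)) (member (claw≡true⇒ clawc))
    where
    member : c ≡ e₁ ⊎ c ≡ e₂ ⊎ c ≡ e₃ → α c ≡ b₁ ⊎ α c ≡ b₂ ⊎ α c ≡ b₃
    member (inj₁ refl)        = inj₁ α₁
    member (inj₂ (inj₁ refl)) = inj₂ (inj₁ α₂)
    member (inj₂ (inj₂ refl)) = inj₂ (inj₂ α₃)

clawMatroid : Matroid 3
clawMatroid = record { E = claw ; E-0 = refl }

anticlawMatroid : Matroid 3
anticlawMatroid = record { E = anticlaw ; E-0 = refl }

standardBasis : IsBasis3 claw
standardBasis = e₁ , e₂ , e₃ , members , independent , spanning
  where
  members : ∀ v → (claw v ≡ true) ⇔ (v ≡ e₁ ⊎ v ≡ e₂ ⊎ v ≡ e₃)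
  members v = mk⇔ claw≡true⇒ λ where
    (inj₁ refl)        → refl
    (inj₂ (inj₁ refl)) → refl
    (inj₂ (inj₂ refl)) → refl
  independent : ∀ c₁ c₂ c₃ → c₁ · e₁ ⊕ c₂ · e₂ ⊕ c₃ · e₃ ≡ 0v → c₁ ≡ false × c₂ ≡ false × c₃ ≡ false
  independent false false false _ = refl , refl , refl
  independent true  true  true  ()
  independent true  true  false ()
  independent true  false true  ()
  independent true  false false ()
  independent false true  true  ()
  independent false true  false ()
  independent false false true  ()
  spanning : ∀ v → ∃[ c₁ ] ∃[ c₂ ] ∃[ c₃ ] c₁ · e₁ ⊕ c₂ · e₂ ⊕ c₃ · e₃ ≡ v
  spanning (c₁ ∷ c₂ ∷ c₃ ∷ []) = c₁ , c₂ , c₃ , coordinates c₁ c₂ c₃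
    where
    coordinates : ∀ c₁ c₂ c₃ → c₁ · e₁ ⊕ c₂ · e₂ ⊕ c₃ · e₃ ≡ c₁ ∷ c₂ ∷ c₃ ∷ []
    coordinates true  true  true  = refl
    coordinates true  true  false = refl
    coordinates true  false true  = refl
    coordinates true  false false = refl
    coordinates false true  true  = refl
    coordinates false true  false = refl
    coordinates false false true  = refl
    coordinates false false false = refl

clawMatroid-isClaw : IsClaw clawMatroid
clawMatroid-isClaw = claw , standardBasis , λ _ → mk⇔ (λ h → h) (λ h → h)

anticlawMatroid-isAnticlaw : IsAnticlaw anticlawMatroid
anticlawMatroid-isAnticlaw = claw , standardBasis , λ v → mk⇔ (to v) (from v)
  where
  to : ∀ v → anticlaw v ≡ true → v ≢ 0v × claw v ≡ false
  to (false ∷ false ∷ false ∷ []) ()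
  to (true ∷ v) h  = (λ ()) , trans (sym (not-involutive _)) (cong not (trans (sym (anticlaw≡not-claw (λ ()))) h))
  to (false ∷ true ∷ v) h = (λ ()) , trans (sym (not-involutive _)) (cong not (trans (sym (anticlaw≡not-claw (λ ()))) h))
  to (false ∷ false ∷ true ∷ []) ()
  from : ∀ v → v ≢ 0v × claw v ≡ false → anticlaw v ≡ true
  from v (v≢0 , clawv) = trans (anticlaw≡not-claw v≢0) (cong not clawv)

Contains₃ : ∀ {n} → (V n → Bool) → (V 3 → Bool) → Set
Contains₃ {n} E p = Σ (V 3 → V n) λ ψ → IsEmbedding ψ × (∀ c → c ≢ 0v → E (ψ c) ≡ p c)

Contains₃-∘ : ∀ {k n} {E : V n → Bool} {φ : V k → V n} {p} → IsEmbedding φ → Contains₃ (E ∘ φ) p → Contains₃ E p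
Contains₃-∘ {φ = φ} φ-emb (ψ , ψ-emb , E≡p) = φ ∘ ψ , ∘-isEmbedding φ-emb ψ-emb , E≡p

-- Contains₃ with the embedding given by the images of a basis, which makes it decidable
Realises₃ : (V 3 → Bool) → (V 3 → Bool) → Set
Realises₃ E p = ∃[ b₁ ] ∃[ b₂ ] ∃[ b₃ ] (∀ c → c ≢ 0v → E (linComb₃ b₁ b₂ b₃ c) ≡ p c) ×
                                        (∀ c → linComb₃ b₁ b₂ b₃ c ≡ 0v → c ≡ 0v)

Realises₃? : ∀ E p → Dec (Realises₃ E p)
Realises₃? E p = ∃V? 3 λ b₁ → ∃V? 3 λ b₂ → ∃V? 3 λ b₃ →
  (∀V? 3 λ c → ¬? (c ≟V 0v) →-dec (E (linComb₃ b₁ b₂ b₃ c) ≟ᵇ p c)) ×-dec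
  (∀V? 3 λ c → (linComb₃ b₁ b₂ b₃ c ≟V 0v) →-dec (c ≟V 0v))

bothSpan₃ : ∀ t → ⟦ t ⟧ 0v ≡ false → BothSpan ⟦ t ⟧ → Realises₃ ⟦ t ⟧ claw ⊎ Realises₃ ⟦ t ⟧ anticlaw
bothSpan₃ = from-yes (∀Table? 3 λ t → (⟦ t ⟧ 0v ≟ᵇ false) →-dec BothSpan? ⟦ t ⟧ →-dec
                                      (Realises₃? ⟦ t ⟧ claw ⊎-dec Realises₃? ⟦ t ⟧ anticlaw))

realises₃⇒contains₃ : ∀ E {p} → Realises₃ E p → Contains₃ E p
realises₃⇒contains₃ _ (b₁ , b₂ , b₃ , E≡p , kernel) =
  linComb₃ b₁ b₂ b₃ , (linComb₃-linear b₁ b₂ b₃ , trivialKernel⇒injective (linComb₃-linear b₁ b₂ b₃) kernel) , E≡p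

Realises₃-⟦table⟧ : ∀ E {p} → Realises₃ ⟦ table E ⟧ p → Realises₃ E p
Realises₃-⟦table⟧ E (b₁ , b₂ , b₃ , E≡p , kernel) =
  b₁ , b₂ , b₃ , (λ c c≢0 → trans (sym (⟦table⟧ E _)) (E≡p c c≢0)) , kernel

bothSpan⇒contains₃ : (E : V 3 → Bool) → E 0v ≡ false → BothSpan E → Contains₃ E claw ⊎ Contains₃ E anticlaw
bothSpan⇒contains₃ E E0 both =
  Sum.map (realises₃⇒contains₃ E ∘ Realises₃-⟦table⟧ E) (realises₃⇒contains₃ E ∘ Realises₃-⟦table⟧ E)
          (bothSpan₃ (table E) (trans (⟦table⟧ E 0v) E0) (BothSpan-cong (sym ∘ ⟦table⟧ E) both))

contains₃-claw⇒¬clawFree : ∀ {n} (M : Matroid n) → Contains₃ (E M) claw → ¬ ClawFree M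
contains₃-claw⇒¬clawFree M (ψ , (ψ-lin , ψ-inj) , E≡claw) clawFree =
  clawFree clawMatroid clawMatroid-isClaw
    (ψ , ψ-lin , ψ-inj , λ c c≢0 → mk⇔ (trans (sym (E≡claw c c≢0))) (trans (E≡claw c c≢0)))

contains₃-anticlaw⇒¬anticlawFree : ∀ {n} (M : Matroid n) → Contains₃ (E M) anticlaw → ¬ AnticlawFree M
contains₃-anticlaw⇒¬anticlawFree M (ψ , (ψ-lin , ψ-inj) , E≡anticlaw) anticlawFree =
  anticlawFree anticlawMatroid anticlawMatroid-isAnticlaw
    (ψ , ψ-lin , ψ-inj , λ c c≢0 → mk⇔ (trans (sym (E≡anticlaw c c≢0))) (trans (E≡anticlaw c c≢0)))

¬bothSpan : ∀ {m} (M : Matroid (suc m)) → ClawFree M → AnticlawFree M → ¬ BothSpan (E M)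
¬bothSpan {zero}        M _ _ both = ¬bothSpan₁ (table (E M)) (BothSpan-cong (sym ∘ ⟦table⟧ (E M)) both)
¬bothSpan {suc zero}    M _ _ both = ¬bothSpan₂ (table (E M)) (BothSpan-cong (sym ∘ ⟦table⟧ (E M)) both)
¬bothSpan {suc (suc m)} M clawFree anticlawFree both = refute (bothSpan⇒contains₃ (E M ∘ φ) E0 both′)
  where
  flat = bothSpan⇒flat₃ m (E M) both
  φ = proj₁ flat
  φ-emb = proj₁ (proj₂ flat)
  both′ = proj₂ (proj₂ flat)
  E0 : E M (φ 0v) ≡ false
  E0 = trans (cong (E M) (linear-0v (proj₁ φ-emb))) (E-0 M)
  refute : Contains₃ (E M ∘ φ) claw ⊎ Contains₃ (E M ∘ φ) anticlaw → ⊥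
  refute (inj₁ c) = contains₃-claw⇒¬clawFree M (Contains₃-∘ {E = E M} φ-emb c) clawFree
  refute (inj₂ c) = contains₃-anticlaw⇒¬anticlawFree M (Contains₃-∘ {E = E M} φ-emb c) anticlawFree

¬Spans⇒monochrome : ∀ {n} (E : V n → Bool) b → ¬ Spans (λ v → E v ≡ b) →
                    ∃[ f ] f ≢ 0v × ∃[ c ] (∀ v → dot f v ≡ true → E v ≡ c)
¬Spans⇒monochrome E b ¬span with ¬Spans⇒annihilator (λ v → E v ≟ᵇ b) ¬span
... | f , f≢0 , f⊥ = f , f≢0 , not b , λ v fv → ¬-not λ Ev≡b → not-¬ (f⊥ v Ev≡b) fv

monochromeComplement : ∀ {m} (M : Matroid (suc m)) → ClawFree M → AnticlawFree M →
                       ∃[ f ] f ≢ 0v × ∃[ b ] (∀ v → dot f v ≡ true → E M v ≡ b)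
monochromeComplement M clawFree anticlawFree =
  decide (Spans? (λ v → E M v ≟ᵇ true)) (Spans? (λ v → E M v ≟ᵇ false))
  where
  decide : Dec (Spans (λ v → E M v ≡ true)) → Dec (Spans (λ v → E M v ≡ false)) →
           ∃[ f ] f ≢ 0v × ∃[ b ] (∀ v → dot f v ≡ true → E M v ≡ b)
  decide (no ¬spanT)  _            = ¬Spans⇒monochrome (E M) true ¬spanT
  decide (yes _)      (no ¬spanF)  = ¬Spans⇒monochrome (E M) false ¬spanF
  decide (yes spanT)  (yes spanF)  = ⊥-elim (¬bothSpan M clawFree anticlawFree (spanT , spanF))

Ultrametric : ∀ {n} → (V n → ℕ) → Set
Ultrametric ℓ = ∀ x y → ℓ (x ⊕ y) ≤ ℓ x ⊔ ℓ y

Odd : ℕ → Set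
Odd l = ∃[ q ] l ≡ suc (2 * q)

record OddLevels {n} (M : Matroid n) : Set where
  field
    height       : ℕ
    level        : V n → ℕ
    level-0v     : level 0v ≡ 0
    level≤height : ∀ v → level v ≤ height
    ultrametric  : Ultrametric level
    E⇔odd        : ∀ v → v ≢ 0v → (E M v ≡ true) ⇔ Odd (level v)

hyperplane : ∀ {m} → Matroid (suc m) → V (suc m) → Matroid m
hyperplane M f = record { E = E M ∘ embed f ; E-0 = trans (cong (E M) (embed-0v f)) (E-0 M) }

hyperplane-free : ∀ {m k} (M : Matroid (suc m)) f {N : Matroid k} → Free N M → Free N (hyperplane M f)
hyperplane-free M f free (φ , φ-lin , φ-inj , φ-E) =
  let (lin , inj) = ∘-isEmbedding (embed-isEmbedding f) (φ-lin , φ-inj) in free (embed f ∘ φ , lin , inj , φ-E)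

topLevel : Bool → ℕ → ℕ
topLevel true  K = suc (2 * K)
topLevel false K = 2 * suc K

topLevel-odd : ∀ b K → (b ≡ true) ⇔ Odd (topLevel b K)
topLevel-odd true  K = mk⇔ (λ _ → K , refl) (λ _ → refl)
topLevel-odd false K = mk⇔ (λ ()) (λ (q , eq) → ⊥-elim (even≢odd (suc K) q eq))

topLevel-≥ : ∀ b K → K ≤ topLevel b K
topLevel-≥ true  K = ≤-trans (m≤n*m K 2) (n≤1+n _)
topLevel-≥ false K = ≤-trans (n≤1+n K) (m≤n*m (suc K) 2)

extendLevel : ∀ {m} → V (suc m) → ℕ → (V m → ℕ) → V (suc m) → ℕ
extendLevel f top ℓ v = if dot f v then top else ℓ (unembed f v)

extendLevel-ultrametric : ∀ {m} {f : V (suc m)} {top} {ℓ : V m → ℕ} → f ≢ 0v → (∀ w → ℓ w ≤ top) →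
                          Ultrametric ℓ → Ultrametric (extendLevel f top ℓ)
extendLevel-ultrametric {f = f} {top} {ℓ} f≢0 ℓ≤top ult x y
  rewrite dot-⊕ʳ f x y with dot f x in fx | dot f y in fy
... | true  | true  = ≤-trans (ℓ≤top _) (m≤m⊔n top top)
... | true  | false = m≤m⊔n top _
... | false | true  = m≤n⊔m _ top
... | false | false = subst (λ w → ℓ w ≤ ℓ (unembed f x) ⊔ ℓ (unembed f y)) (sym (unembed-linear f f≢0 fx fy)) (ult _ _)

extendOddLevels : ∀ {m} (M : Matroid (suc m)) {f} → f ≢ 0v → ∀ b → (∀ v → dot f v ≡ true → E M v ≡ b) →
                  OddLevels (hyperplane M f) → OddLevels M
extendOddLevels M {f} f≢0 b mono L = record
  { height       = top
  ; level        = extendLevel f top level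
  ; level-0v     = trans (cong (λ c → if c then top else level (unembed f 0v)) (dot-0vʳ f))
                         (trans (cong level (unembed-0v f)) level-0v)
  ; level≤height = level≤top
  ; ultrametric  = extendLevel-ultrametric f≢0 (λ w → ≤-trans (level≤height w) (topLevel-≥ b height)) ultrametric
  ; E⇔odd        = E⇔odd′
  }
  where
  open OddLevels L
  top = topLevel b height
  level≤top : ∀ v → extendLevel f top level v ≤ top
  level≤top v with dot f v
  ... | true  = ≤-refl
  ... | false = ≤-trans (level≤height _) (topLevel-≥ b height)
  E⇔odd′ : ∀ v → v ≢ 0v → (E M v ≡ true) ⇔ Odd (extendLevel f top level v)
  E⇔odd′ v v≢0 with dot f v in fv
  ... | true  = mk⇔ (λ Ev → Equivalence.to (topLevel-odd b height) (trans (sym (mono v fv)) Ev))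
                    (λ odd → trans (mono v fv) (Equivalence.from (topLevel-odd b height) odd))
  ... | false = subst (λ u → (E M u ≡ true) ⇔ Odd (level (unembed f v))) v≡
                      (E⇔odd (unembed f v) λ w≡0 → v≢0 (trans (sym v≡) (trans (cong (embed f) w≡0) (embed-0v f))))
    where
    v≡ : embed f (unembed f v) ≡ v
    v≡ = embed-unembed f f≢0 fv

oddLevels : ∀ n (M : Matroid n) → ClawFree M → AnticlawFree M → OddLevels M
oddLevels zero M _ _ = record
  { height = 0 ; level = λ _ → 0 ; level-0v = refl ; level≤height = λ _ → z≤n
  ; ultrametric = λ _ _ → z≤n ; E⇔odd = λ { [] v≢0 → ⊥-elim (v≢0 refl) } }
oddLevels (suc m) M clawFree anticlawFree =
  let (f , f≢0 , b , mono) = monochromeComplement M clawFree anticlawFree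
  in extendOddLevels M f≢0 b mono
       (oddLevels m (hyperplane M f) (λ N isClaw → hyperplane-free M f {N} (clawFree N isClaw))
                                      (λ N isAnticlaw → hyperplane-free M f {N} (anticlawFree N isAnticlaw)))

EvenStep : ∀ {k} → (Fin (suc k) → Bool) → Set
EvenStep {k} σ = ∃[ i ] (2 ∣ toℕ {k} i) × σ (fsuc i) ≡ true × σ (inject₁ i) ≡ false

OddBelow : ℕ → ℕ → Set
OddBelow k l = ∃[ i ] (2 ∣ toℕ {k} i) × l ≡ suc (toℕ i)

evenStep⇔oddBelow : ∀ {k} {σ : Fin (suc k) → Bool} {l} → (∀ j → (l ≤ toℕ j) ⇔ (σ j ≡ true)) →
                    EvenStep σ ⇔ OddBelow k l
evenStep⇔oddBelow {k} {σ} {l} l≤⇔σ = mk⇔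
  (λ (i , even , σ₁ , σ₀) → i , even , ≤-antisym (from (fsuc i) σ₁) (≰⇒> (not-below i σ₀)))
  (λ (i , even , l≡) → i , even , to (fsuc i) (≤-reflexive l≡) ,
                       ¬-not λ σ₀ → <-irrefl refl (subst (_≤ toℕ i) l≡ (subst (l ≤_) (toℕ-inject₁ i) (from (inject₁ i) σ₀))))
  where
  to = λ j → Equivalence.to (l≤⇔σ j)
  from = λ j → Equivalence.from (l≤⇔σ j)
  not-below : ∀ i → σ (inject₁ i) ≡ false → ¬ l ≤ toℕ i
  not-below i σ₀ l≤i = not-¬ σ₀ (to (inject₁ i) (subst (l ≤_) (sym (toℕ-inject₁ i)) l≤i))

odd⇔oddBelow : ∀ {k l} → l ≤ k → Odd l ⇔ OddBelow k l
odd⇔oddBelow {k} {l} l≤k = mk⇔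
  (λ (q , l≡) → let 2q<k = subst (_≤ k) l≡ l≤k in
                fromℕ< 2q<k , divides q (trans (toℕ-fromℕ< 2q<k) (*-comm 2 q)) ,
                trans l≡ (cong suc (sym (toℕ-fromℕ< 2q<k))))
  (λ (i , divides q i≡ , l≡) → q , trans l≡ (cong suc (trans i≡ (*-comm q 2))))

oddLevels⇒target : ∀ {n} {M : Matroid n} → OddLevels M → IsTarget M
oddLevels⇒target {n} {M} L = height , S , subspace , chain , E⇔evenStep
  where
  open OddLevels L
  S : Fin (suc height) → V n → Bool
  S i v = does (level v ≤? toℕ i)
  level≤⇔S : ∀ v j → (level v ≤ toℕ j) ⇔ (S j v ≡ true)
  level≤⇔S v j = mk⇔ (dec-true (level v ≤? toℕ j)) λ Sv → decidable-stable (level v ≤? toℕ j) λ ¬≤ →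
                   not-¬ (dec-false (level v ≤? toℕ j) ¬≤) Sv
  subspace : ∀ i → IsSubspace (S i)
  subspace i = Equivalence.to (level≤⇔S 0v i) (subst (_≤ toℕ i) (sym level-0v) z≤n) ,
               λ x y Sx Sy → Equivalence.to (level≤⇔S (x ⊕ y) i)
                 (≤-trans (ultrametric x y) (⊔-lub (Equivalence.from (level≤⇔S x i) Sx) (Equivalence.from (level≤⇔S y i) Sy)))
  chain : ∀ (i : Fin height) v → S (inject₁ i) v ≡ true → S (fsuc i) v ≡ true
  chain i v S₀ = Equivalence.to (level≤⇔S v (fsuc i))
    (≤-trans (subst (level v ≤_) (toℕ-inject₁ i) (Equivalence.from (level≤⇔S v (inject₁ i)) S₀)) (n≤1+n _))
  E⇔evenStep : ∀ v → v ≢ 0v → (E M v ≡ true) ⇔ EvenStep (λ i → S i v)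
  E⇔evenStep v v≢0 = ⇔-trans (E⇔odd v v≢0) (⇔-trans (odd⇔oddBelow (level≤height v)) (⇔-sym (evenStep⇔oddBelow (level≤⇔S v))))

Monotone : ∀ {k} → (Fin (suc k) → Bool) → Set
Monotone {k} σ = ∀ (i : Fin k) → σ (inject₁ i) ≡ true → σ (fsuc i) ≡ true

firstTrue : ∀ {k} → (Fin (suc k) → Bool) → ℕ
firstTrue {zero}  σ = if σ fzero then 0 else 1
firstTrue {suc k} σ = if σ fzero then 0 else suc (firstTrue (σ ∘ fsuc))

firstTrue≤suc : ∀ {k} (σ : Fin (suc k) → Bool) → firstTrue σ ≤ suc k
firstTrue≤suc {zero}  σ with σ fzero
... | true  = z≤n
... | false = s≤s z≤n
firstTrue≤suc {suc k} σ with σ fzero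
... | true  = z≤n
... | false = s≤s (firstTrue≤suc (σ ∘ fsuc))

firstTrue≤ : ∀ {k} (σ : Fin (suc k) → Bool) j → σ j ≡ true → firstTrue σ ≤ toℕ j
firstTrue≤ {zero}  σ fzero σj rewrite σj = z≤n
firstTrue≤ {suc k} σ j σj with σ fzero in σ₀
... | true = z≤n
firstTrue≤ {suc k} σ fzero    σj | false = ⊥-elim (not-¬ σ₀ σj)
firstTrue≤ {suc k} σ (fsuc j) σj | false = s≤s (firstTrue≤ (σ ∘ fsuc) j σj)

monotone-true : ∀ {k} (σ : Fin (suc k) → Bool) → Monotone σ → σ fzero ≡ true → ∀ j → σ j ≡ true
monotone-true {zero}  σ mono σ₀ fzero    = σ₀
monotone-true {suc k} σ mono σ₀ fzero    = σ₀
monotone-true {suc k} σ mono σ₀ (fsuc j) = monotone-true (σ ∘ fsuc) (mono ∘ fsuc) (mono fzero σ₀) j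

≤firstTrue⇒ : ∀ {k} (σ : Fin (suc k) → Bool) → Monotone σ → ∀ j → firstTrue σ ≤ toℕ j → σ j ≡ true
≤firstTrue⇒ {zero}  σ mono fzero le with σ fzero
... | true  = refl
... | false with le
...   | ()
≤firstTrue⇒ {suc k} σ mono j le with σ fzero in σ₀
... | true = monotone-true σ mono σ₀ j
≤firstTrue⇒ {suc k} σ mono fzero    ()        | false
≤firstTrue⇒ {suc k} σ mono (fsuc j) (s≤s le) | false = ≤firstTrue⇒ (σ ∘ fsuc) (mono ∘ fsuc) j le

firstTrue≤⇔ : ∀ {k} (σ : Fin (suc k) → Bool) → Monotone σ → ∀ j → (firstTrue σ ≤ toℕ j) ⇔ (σ j ≡ true)
firstTrue≤⇔ σ mono j = mk⇔ (≤firstTrue⇒ σ mono j) (firstTrue≤ σ j)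

target⇒levels : ∀ {n} (M : Matroid n) → IsTarget M →
                Σ (V n → ℕ) λ ℓ → Ultrametric ℓ × Σ (ℕ → Set) λ P → ∀ v → v ≢ 0v → (E M v ≡ true) ⇔ P (ℓ v)
target⇒levels M (k , S , subspace , chain , E⇔) =
  ℓ , ultrametric , OddBelow k , λ v v≢0 → ⇔-trans (E⇔ v v≢0) (evenStep⇔oddBelow (firstTrue≤⇔ _ (λ i → chain i v)))
  where
  ℓ = λ v → firstTrue (λ i → S i v)
  ultrametric : Ultrametric ℓ
  ultrametric x y with ℓ x ⊔ ℓ y <? suc k
  ... | yes lt = subst (ℓ (x ⊕ y) ≤_) (toℕ-fromℕ< lt)
                   (firstTrue≤ _ j (proj₂ (subspace j) x y (in-j x (m≤m⊔n (ℓ x) (ℓ y))) (in-j y (m≤n⊔m (ℓ x) (ℓ y)))))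
    where
    j = fromℕ< lt
    in-j : ∀ z → ℓ z ≤ ℓ x ⊔ ℓ y → S j z ≡ true
    in-j z le = ≤firstTrue⇒ _ (λ i → chain i z) j (subst (ℓ z ≤_) (sym (toℕ-fromℕ< lt)) le)
  ... | no ¬lt = ≤-trans (firstTrue≤suc _) (≮⇒≥ ¬lt)

ultrametric-∘ : ∀ {k n} {ℓ : V n → ℕ} {φ : V k → V n} → Ultrametric ℓ → IsLinear φ → Ultrametric (ℓ ∘ φ)
ultrametric-∘ {ℓ = ℓ} {φ} ult φ-lin x y = subst (λ z → ℓ z ≤ ℓ (φ x) ⊔ ℓ (φ y)) (sym (φ-lin x y)) (ult (φ x) (φ y))

module _ {n} (ℓ : V n → ℕ) (ult : Ultrametric ℓ) where

  ultrametric-< : ∀ {x y} → ℓ x < ℓ y → ℓ (x ⊕ y) ≡ ℓ y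
  ultrametric-< {x} {y} lt = ≤-antisym (≤-trans (ult x y) (≤-reflexive (m≤n⇒m⊔n≡n (<⇒≤ lt)))) (≮⇒≥ λ lt′ →
    <-irrefl refl (≤-<-trans (subst (λ z → ℓ z ≤ ℓ x ⊔ ℓ (x ⊕ y)) (⊕-cancelˡ x y) (ult x (x ⊕ y))) (⊔-pres-<m lt lt′)))

  sameLevel : (P : ℕ → Set) → ∀ {x y} → P (ℓ x) → P (ℓ y) → ¬ P (ℓ (x ⊕ y)) → ℓ x ≡ ℓ y
  sameLevel P {x} {y} px py ¬pxy with <-cmp (ℓ x) (ℓ y)
  ... | tri< lt _ _ = ⊥-elim (¬pxy (subst P (sym (ultrametric-< lt)) py))
  ... | tri≈ _ eq _ = eq
  ... | tri> _ _ gt = ⊥-elim (¬pxy (subst P (sym (trans (cong ℓ (⊕-comm x y)) (ultrametric-< gt))) px))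

  sameLevel⇒≤ : ∀ {x y} → ℓ x ≡ ℓ y → ℓ (x ⊕ y) ≤ ℓ x
  sameLevel⇒≤ {x} {y} eq = ≤-trans (ult x y) (≤-reflexive (trans (cong (ℓ x ⊔_) (sym eq)) (⊔-idem (ℓ x))))

  belowSameLevel : (P : ℕ → Set) → ∀ {x y} → ℓ x ≡ ℓ y → P (ℓ x) → ¬ P (ℓ (x ⊕ y)) → ℓ (x ⊕ y) < ℓ x
  belowSameLevel P eq px ¬pxy = ≤∧≢⇒< (sameLevel⇒≤ eq) (λ eq′ → ¬pxy (subst P (sym eq′) px))

¬ultrametricClaw : (ℓ : V 3 → ℕ) → Ultrametric ℓ → (P : ℕ → Set) →
                   (∀ c → c ≢ 0v → P (ℓ c) ⇔ (claw c ≡ true)) → ⊥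
¬ultrametricClaw ℓ ult P P⇔ = hasn't (λ ()) refl (subst P (sym ℓ₁₂₃≡ℓ₁) (has {e₁} (λ ()) refl))
  where
  has : ∀ {c} → c ≢ 0v → claw c ≡ true → P (ℓ c)
  has c≢0 = Equivalence.from (P⇔ _ c≢0)
  hasn't : ∀ {c} → c ≢ 0v → claw c ≡ false → ¬ P (ℓ c)
  hasn't c≢0 clawc p = not-¬ clawc (Equivalence.to (P⇔ _ c≢0) p)
  ℓ₁≡ℓ₂ = sameLevel ℓ ult P {e₁} {e₂} (has (λ ()) refl) (has (λ ()) refl) (hasn't (λ ()) refl)
  ℓ₁≡ℓ₃ = sameLevel ℓ ult P {e₁} {e₃} (has (λ ()) refl) (has (λ ()) refl) (hasn't (λ ()) refl)
  ℓ₁₂<ℓ₁ = belowSameLevel ℓ ult P ℓ₁≡ℓ₂ (has (λ ()) refl) (hasn't (λ ()) refl)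
  ℓ₁₃<ℓ₁ = belowSameLevel ℓ ult P ℓ₁≡ℓ₃ (has (λ ()) refl) (hasn't (λ ()) refl)
  ℓ₂₃<ℓ₁ : ℓ (e₂ ⊕ e₃) < ℓ e₁
  ℓ₂₃<ℓ₁ = ≤-<-trans (ult (e₁ ⊕ e₂) (e₁ ⊕ e₃)) (⊔-pres-<m ℓ₁₂<ℓ₁ ℓ₁₃<ℓ₁)
  ℓ₁₂₃≡ℓ₁ : ℓ (e₂ ⊕ e₃ ⊕ e₁) ≡ ℓ e₁
  ℓ₁₂₃≡ℓ₁ = ultrametric-< ℓ ult ℓ₂₃<ℓ₁

¬ultrametricAnticlaw : (ℓ : V 3 → ℕ) → Ultrametric ℓ → (P : ℕ → Set) →
                       (∀ c → c ≢ 0v → P (ℓ c) ⇔ (anticlaw c ≡ true)) → ⊥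
¬ultrametricAnticlaw ℓ ult P P⇔ = <-irrefl ℓ₁₂≡ℓ₁₂₃ (≤-<-trans (ult e₁ e₂) (⊔-pres-<m ℓ₁<ℓ₁₂₃ ℓ₂<ℓ₁₂₃))
  where
  has : ∀ {c} → c ≢ 0v → anticlaw c ≡ true → P (ℓ c)
  has c≢0 = Equivalence.from (P⇔ _ c≢0)
  hasn't : ∀ {c} → c ≢ 0v → anticlaw c ≡ false → ¬ P (ℓ c)
  hasn't c≢0 anticlawc p = not-¬ anticlawc (Equivalence.to (P⇔ _ c≢0) p)
  e₁₂₃ = e₁ ⊕ e₂ ⊕ e₃
  ℓ₁₂₃≡ℓ₂₃ = sameLevel ℓ ult P {e₁₂₃} {e₂ ⊕ e₃} (has (λ ()) refl) (has (λ ()) refl) (hasn't (λ ()) refl)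
  ℓ₁₂₃≡ℓ₁₃ = sameLevel ℓ ult P {e₁₂₃} {e₁ ⊕ e₃} (has (λ ()) refl) (has (λ ()) refl) (hasn't (λ ()) refl)
  ℓ₁₂≡ℓ₁₂₃ = sym (sameLevel ℓ ult P {e₁₂₃} {e₁ ⊕ e₂} (has (λ ()) refl) (has (λ ()) refl) (hasn't (λ ()) refl))
  ℓ₁<ℓ₁₂₃ = belowSameLevel ℓ ult P {e₁₂₃} {e₂ ⊕ e₃} ℓ₁₂₃≡ℓ₂₃ (has (λ ()) refl) (hasn't (λ ()) refl)
  ℓ₂<ℓ₁₂₃ = belowSameLevel ℓ ult P {e₁₂₃} {e₁ ⊕ e₃} ℓ₁₂₃≡ℓ₁₃ (has (λ ()) refl) (hasn't (λ ()) refl)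

pullbackLevels : ∀ {n} {E : V n → Bool} (ℓ : V n → ℕ) {p} → Ultrametric ℓ → (P : ℕ → Set) →
                 (∀ v → v ≢ 0v → (E v ≡ true) ⇔ P (ℓ v)) → Contains₃ E p →
                 Σ (V 3 → ℕ) λ ℓ₃ → Ultrametric ℓ₃ × (∀ c → c ≢ 0v → P (ℓ₃ c) ⇔ (p c ≡ true))
pullbackLevels ℓ ult P E⇔P (ψ , ψ-emb , E≡p) =
  ℓ ∘ ψ , ultrametric-∘ {ℓ = ℓ} {ψ} ult (proj₁ ψ-emb) , λ c c≢0 →
    let E⇔P′ = E⇔P (ψ c) (embedding-≢0v ψ-emb c≢0)
    in mk⇔ (λ p → trans (sym (E≡p c c≢0)) (Equivalence.from E⇔P′ p)) (λ q → Equivalence.to E⇔P′ (trans (E≡p c c≢0) q))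

clawRestriction⇒contains₃ : ∀ {n} {M : Matroid n} {N : Matroid 3} → IsClaw N → HasRestrictionIso M N →
                            Contains₃ (E M) claw
clawRestriction⇒contains₃ {M = M} {N} (B , (b₁ , b₂ , b₃ , members , independent , _) , E⇔B) (φ , φ-lin , φ-inj , φ-E) =
  φ ∘ α , ∘-isEmbedding (φ-lin , φ-inj) α-emb , λ c c≢0 → begin
    E M (φ (α c))  ≡⟨ ≡true⇔⇒≡ (φ-E (α c) (embedding-≢0v α-emb c≢0)) ⟩
    E N (α c)      ≡⟨ ≡true⇔⇒≡ (E⇔B (α c)) ⟩
    B (α c)        ≡⟨ basis-claw members kernel c ⟩
    claw c         ∎
  where
  open ≡-Reasoning
  α = linComb₃ b₁ b₂ b₃
  kernel : ∀ c → α c ≡ 0v → c ≡ 0v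
  kernel = independent⇒trivialKernel independent
  α-emb : IsEmbedding α
  α-emb = linComb₃-linear b₁ b₂ b₃ , trivialKernel⇒injective (linComb₃-linear b₁ b₂ b₃) kernel

anticlawRestriction⇒contains₃ : ∀ {n} {M : Matroid n} {N : Matroid 3} → IsAnticlaw N → HasRestrictionIso M N →
                                Contains₃ (E M) anticlaw
anticlawRestriction⇒contains₃ {M = M} {N} (B , (b₁ , b₂ , b₃ , members , independent , _) , E⇔) (φ , φ-lin , φ-inj , φ-E) =
  φ ∘ α , ∘-isEmbedding (φ-lin , φ-inj) α-emb , λ c c≢0 →
    trans (≡true⇔⇒≡ (φ-E (α c) (embedding-≢0v α-emb c≢0))) (≡true⇔⇒≡ (⇔-trans (E⇔ (α c)) (anticlaw⇔ c≢0)))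
  where
  α = linComb₃ b₁ b₂ b₃
  kernel : ∀ c → α c ≡ 0v → c ≡ 0v
  kernel = independent⇒trivialKernel independent
  α-emb : IsEmbedding α
  α-emb = linComb₃-linear b₁ b₂ b₃ , trivialKernel⇒injective (linComb₃-linear b₁ b₂ b₃) kernel
  anticlaw⇔ : ∀ {c} → c ≢ 0v → (α c ≢ 0v × B (α c) ≡ false) ⇔ (anticlaw c ≡ true)
  anticlaw⇔ {c} c≢0 = mk⇔
    (λ (_ , Bαc) → trans (anticlaw≡not-claw c≢0) (cong not (trans (sym (basis-claw members kernel c)) Bαc)))
    (λ ac → embedding-≢0v α-emb c≢0 , trans (basis-claw members kernel c) (anticlaw≡true⇒claw≡false c≢0 ac))

levels⇒clawFree : ∀ {n} (M : Matroid n) (ℓ : V n → ℕ) → Ultrametric ℓ → (P : ℕ → Set) →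
                  (∀ v → v ≢ 0v → (E M v ≡ true) ⇔ P (ℓ v)) → ClawFree M
levels⇒clawFree M ℓ ult P E⇔P N isClaw restriction =
  let (ℓ₃ , ult₃ , P⇔) = pullbackLevels ℓ ult P E⇔P (clawRestriction⇒contains₃ {M = M} {N} isClaw restriction)
  in ¬ultrametricClaw ℓ₃ ult₃ P P⇔

levels⇒anticlawFree : ∀ {n} (M : Matroid n) (ℓ : V n → ℕ) → Ultrametric ℓ → (P : ℕ → Set) →
                      (∀ v → v ≢ 0v → (E M v ≡ true) ⇔ P (ℓ v)) → AnticlawFree M
levels⇒anticlawFree M ℓ ult P E⇔P N isAnticlaw restriction =
  let (ℓ₃ , ult₃ , P⇔) = pullbackLevels ℓ ult P E⇔P (anticlawRestriction⇒contains₃ {M = M} {N} isAnticlaw restriction)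
  in ¬ultrametricAnticlaw ℓ₃ ult₃ P P⇔

theorem1p11 : (n : ℕ) (M : Matroid n) →
    ((ClawFree M × AnticlawFree M) ⇔ IsTarget M)
theorem1p11 n M = mk⇔
  (λ (clawFree , anticlawFree) → oddLevels⇒target (oddLevels n M clawFree anticlawFree))
  (λ target → let (ℓ , ult , P , E⇔P) = target⇒levels M target
              in levels⇒clawFree M ℓ ult P E⇔P , levels⇒anticlawFree M ℓ ult P E⇔P)
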